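{- For all integers $n\geq 2$, the difference $\widetilde{P}_n(X) - F_{n-1}(X)$ is a polynomial of degree $< n/2 - 1$.
   Context: For a prime power $q$, let $C_n(q)$ be the number of ideals $I$ of $\mathbb{F}_q[x,y,x^{ -1},y^{ -1}]$ of codimension $n$ (i.e. $\dim_{\mathbb{F}_q}$ of the quotient is $n$). It is known that $C_n(q)$ is a palindromic polynomial of degree $2n$ in $q$ with integer coefficients, divisible by $(q-1)^2$; set $P_n(q)=C_n(q)/(q-1)^2$ (palindromic of degree $2n-2$) and define $\widetilde{P}_n(X)\in\mathbb{Z}[X]$ (of degree $n-1$) by $\widetilde{P}_n(q+q^{ -1}) = P_n(q)/q^{n-1}$. Equivalently, $1 + (X - 2) \sum_{n\geq 1} \widetilde{P}_n (X)\, t^n = \prod_{i\geq 1} \frac{(1-t^i)^2}{1- X t^i + t^{2i}}$ as formal power series. The monic Chebyshev polynomials $\mathcal{T}_k(X)$ are defined by $q^k+q^{ -k}=\mathcal{T}_k(q+q^{ -1})$, and $F_k(X) = 1 + \sum_{m=1}^{k}\mathcal{T}_m(X)$ for $k\geq 0$. -}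

module Defs where

open import Data.Nat using (ℕ; zero; suc; _∸_; _≤_; _≡ᵇ_) renaming (_*_ to _*ℕ_)
open import Data.Integer using (ℤ; 0ℤ; 1ℤ; +_; -_; _+_; _*_)
open import Data.List using (List; []; _∷_; map)
open import Data.Product using (_×_; _,_; proj₁)
open import Data.Bool using (if_then_else_)
open import Relation.Binary.PropositionalEquality using (_≡_)

-- Polynomials in ℤ[X] as coefficient lists, lowest degree first.
-- (Trailing zeros allowed; polynomials are compared via coefficients.)

Poly : Set
Poly = List ℤ

coeff : Poly → ℕ → ℤ
coeff []       _       = 0ℤ
coeff (a ∷ p)  zero    = a
coeff (a ∷ p)  (suc k) = coeff p k

const : ℤ → Poly
const c = c ∷ []

Xₚ : Poly
Xₚ = 0ℤ ∷ 1ℤ ∷ []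

infixl 6 _+ₚ_ _-ₚ_
infixl 7 _*ₚ_

_+ₚ_ : Poly → Poly → Poly
[]      +ₚ q       = q
(a ∷ p) +ₚ []      = a ∷ p
(a ∷ p) +ₚ (b ∷ q) = (a + b) ∷ (p +ₚ q)

negₚ : Poly → Poly
negₚ = map -_

_-ₚ_ : Poly → Poly → Poly
p -ₚ q = p +ₚ negₚ q

scaleₚ : ℤ → Poly → Poly
scaleₚ c = map (c *_)

_*ₚ_ : Poly → Poly → Poly
[]      *ₚ q = []
(a ∷ p) *ₚ q = scaleₚ a q +ₚ (0ℤ ∷ (p *ₚ q))

-- Synthetic division by (X - 2): returns (quotient , remainder).
-- If p = a + X p' and p' = (X-2) q' + r', then
-- p = (X-2) (r' + X q') + (a + 2 r').
divX-2 : Poly → Poly × ℤ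
divX-2 []      = [] , 0ℤ
divX-2 (a ∷ p) with divX-2 p
... | q' , r' = (r' ∷ q') , (a + (+ 2) * r')

quotX-2 : Poly → Poly
quotX-2 p = proj₁ (divX-2 p)

-- Formal power series in t with coefficients in ℤ[X]:
-- a series is the function giving the coefficient of t^m.

Series : Set
Series = ℕ → Poly

Σ≤ : ℕ → (ℕ → Poly) → Poly
Σ≤ zero    f = f zero
Σ≤ (suc m) f = Σ≤ m f +ₚ f (suc m)

_+ₛ_ : Series → Series → Series
(f +ₛ g) m = f m +ₚ g m

_-ₛ_ : Series → Series → Series
(f -ₛ g) m = f m -ₚ g m

_*ₛ_ : Series → Series → Series
(f *ₛ g) m = Σ≤ m (λ j → f j *ₚ g (m ∸ j))

oneₛ : Series
oneₛ zero    = const 1ℤ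
oneₛ (suc _) = []

monoₛ : ℕ → Poly → Series
monoₛ i c m = if m ≡ᵇ i then c else []

powₛ : Series → ℕ → Series
powₛ f zero    = oneₛ
powₛ f (suc k) = f *ₛ powₛ f k

-- Σ_{k=0}^{N} u^k ; equals 1/(1-u) modulo t^(N+1) when u has zero
-- constant term.
geomₛ : ℕ → Series → Series
geomₛ N u m = Σ≤ N (λ k → powₛ u k m)

-- The i-th factor (1 - t^i)^2 / (1 - X t^i + t^(2i)), correct modulo t^(N+1)
-- (for i ≥ 1).
factorₛ : ℕ → ℕ → Series
factorₛ N i =
  powₛ (oneₛ -ₛ monoₛ i (const 1ℤ)) 2
  *ₛ geomₛ N (monoₛ i Xₚ -ₛ monoₛ (2 *ℕ i) (const 1ℤ))

prodₛ : ℕ → ℕ → Series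
prodₛ N zero    = oneₛ
prodₛ N (suc k) = prodₛ N k *ₛ factorₛ N (suc k)

-- Coefficient of t^n in ∏_{i ≥ 1} (1-t^i)^2/(1 - X t^i + t^(2i))
-- (factors with i > n, and all truncations, do not affect it).
rhsCoeff : ℕ → Poly
rhsCoeff n = prodₛ n n n

-- P̃_n(X), n ≥ 1, determined by
-- 1 + (X-2) Σ_{n≥1} P̃_n(X) t^n = ∏_{i≥1} (1-t^i)^2/(1 - X t^i + t^(2i)).
P̃ : ℕ → Poly
P̃ n = quotX-2 (rhsCoeff n)

-- Monic Chebyshev polynomials: 𝒯_0 = 2, 𝒯_1 = X, 𝒯_{k+2} = X 𝒯_{k+1} - 𝒯_k
-- (equivalently q^k + q^{-k} = 𝒯_k(q + q^{-1})).

𝒯 : ℕ → Poly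
𝒯 zero          = const (+ 2)
𝒯 (suc zero)    = Xₚ
𝒯 (suc (suc k)) = Xₚ *ₚ 𝒯 (suc k) -ₚ 𝒯 k

F : ℕ → Poly
F zero    = const 1ℤ
F (suc k) = F k +ₚ 𝒯 (suc k)

-- deg p < m / 2  (zero polynomial has degree -∞): every coefficient of
-- index k with 2k ≥ m vanishes.
DegLtHalf : Poly → ℕ → Set
DegLtHalf p m = ∀ k → m ≤ 2 *ℕ k → coeff p k ≡ 0ℤ

-- Let κ = Σₘ 𝒯ₘ tᵐ with constant term 1, so that κ = (1 − t²)/(1 − X t + t²), and let Πₖ
-- be the product of the first k factors (1 − tⁱ)²/(1 − X tⁱ + t²ⁱ). For k ≥ 1 the error
-- Eₖ = Πₖ − (1 − t)(1 − tᵏ)/(1 − tᵏ⁺¹) · κ contains only monomials Xʲtᵐ with m ≥ 2j + 1: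
-- E₁ = 0, and
--   Eₖ₊₁ = Eₖ fₖ₊₁ − (1 − t)(1 − t²)(1 − tᵏ⁺¹) tᵏ / ((1 − tᵏ⁺²)(1 − X tᵏ⁺¹ + t²ᵏ⁺²)),
-- where fₖ₊₁ has no monomial with m < 2j and the subtracted term none with m < (k+1) j + k.
-- Reading off tⁿ from Πₙ, every coefficient of Xᴶ with J ≥ 1 and 2J ≥ n agrees with that
-- of 𝒯ₙ − 𝒯ₙ₋₁ = (X − 2) Fₙ₋₁. So (X − 2)(P̃ₙ − Fₙ₋₁) has no such monomials, and dividing
-- by X − 2 from the top coefficient down (pⱼ = 2 pⱼ₊₁) kills the coefficients of
-- P̃ₙ − Fₙ₋₁ of index j with 2j ≥ n − 2.

module Submission where

open import Defs
open import Data.Nat using (ℕ; _≤_; _∸_)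

open import Algebra.Bundles using (CommutativeSemiring; CommutativeRing)
open import Algebra.Morphism.Structures using (IsRingMonomorphism)
import Algebra.Morphism.RingMonomorphism as RingMonomorphism
open import Algebra.Solver.Ring.AlmostCommutativeRing
  using (fromCommutativeRing; _-Raw-AlmostCommutative⟶_)
open import Data.Bool using (true; false)
open import Data.Empty using (⊥-elim)
open import Data.Integer as ℤ using (ℤ; 0ℤ; 1ℤ; +_)
import Data.Integer.Properties as ℤ
open import Data.List using ([]; _∷_; length)
open import Data.Maybe using (Maybe; just; nothing)
open import Data.Nat as ℕ using (zero; suc; _<_; z≤n; s≤s; _≡ᵇ_)
import Data.Nat.Properties as ℕ
open import Data.Nat.Tactic.RingSolver using (solve-∀)
open import Data.Product using (_,_; proj₁; proj₂)
open import Data.Unit using (⊤; tt)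
open import Relation.Binary.PropositionalEquality as ≡ using (_≡_; _≢_)
open import Relation.Nullary using (¬_; yes; no)

module SumsOver {c ℓ} (R : CommutativeSemiring c ℓ) where
  open CommutativeSemiring R hiding (zero)
  open import Relation.Binary.Reasoning.Setoid setoid

  sum≤ : ℕ → (ℕ → Carrier) → Carrier
  sum≤ zero    f = f zero
  sum≤ (suc m) f = sum≤ m f + f (suc m)

  sum≤-cong : ∀ m {f g} → (∀ j → j ≤ m → f j ≈ g j) → sum≤ m f ≈ sum≤ m g
  sum≤-cong zero    f≈g = f≈g zero z≤n
  sum≤-cong (suc m) f≈g =
    +-cong (sum≤-cong m λ j j≤m → f≈g j (ℕ.m≤n⇒m≤1+n j≤m)) (f≈g (suc m) ℕ.≤-refl)

  sum≤-zero : ∀ m {f} → (∀ j → j ≤ m → f j ≈ 0#) → sum≤ m f ≈ 0#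
  sum≤-zero m f≈0 = trans (sum≤-cong m f≈0) (sum≤-const0 m)
    where
    sum≤-const0 : ∀ m → sum≤ m (λ _ → 0#) ≈ 0#
    sum≤-const0 zero    = refl
    sum≤-const0 (suc m) = trans (+-identityʳ _) (sum≤-const0 m)

  sum≤-distrib-+ : ∀ m f g → sum≤ m (λ j → f j + g j) ≈ sum≤ m f + sum≤ m g
  sum≤-distrib-+ zero    f g = refl
  sum≤-distrib-+ (suc m) f g =
    trans (+-congʳ (sum≤-distrib-+ m f g)) (interchange _ _ _ _)
    where open import Algebra.Properties.CommutativeSemigroup +-commutativeSemigroup using (interchange)

  *-distribˡ-sum≤ : ∀ m a f → a * sum≤ m f ≈ sum≤ m (λ j → a * f j)
  *-distribˡ-sum≤ zero    a f = refl
  *-distribˡ-sum≤ (suc m) a f = trans (distribˡ _ _ _) (+-congʳ (*-distribˡ-sum≤ m a f))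

  *-distribʳ-sum≤ : ∀ m a f → sum≤ m f * a ≈ sum≤ m (λ j → f j * a)
  *-distribʳ-sum≤ m a f =
    trans (*-comm _ _) (trans (*-distribˡ-sum≤ m a f) (sum≤-cong m λ _ _ → *-comm _ _))

  sum≤-suc-first : ∀ m f → sum≤ (suc m) f ≈ f zero + sum≤ m (λ j → f (suc j))
  sum≤-suc-first zero    f = refl
  sum≤-suc-first (suc m) f = trans (+-congʳ (sum≤-suc-first m f)) (+-assoc _ _ _)

  sum≤-reverse : ∀ m f → sum≤ m f ≈ sum≤ m (λ j → f (m ∸ j))
  sum≤-reverse zero    f = refl
  sum≤-reverse (suc m) f = begin
    sum≤ m f + f (suc m)                   ≈⟨ +-comm _ _ ⟩
    f (suc m) + sum≤ m f                   ≈⟨ +-congˡ (sum≤-reverse m f) ⟩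
    f (suc m) + sum≤ m (λ j → f (m ∸ j))   ≈⟨ sum≤-suc-first m (λ j → f (suc m ∸ j)) ⟨
    sum≤ (suc m) (λ j → f (suc m ∸ j))     ∎

  sum≤-single : ∀ m i f → i ≤ m → (∀ j → j ≤ m → ¬ j ≡ i → f j ≈ 0#) → sum≤ m f ≈ f i
  sum≤-single zero    zero f z≤n f≈0 = refl
  sum≤-single (suc m) i    f i≤ f≈0 with i ℕ.≟ suc m
  ... | yes ≡.refl = trans (+-congʳ (sum≤-zero m λ j j≤m →
                     f≈0 j (ℕ.m≤n⇒m≤1+n j≤m) λ { ≡.refl → ℕ.1+n≰n j≤m }))
                   (+-identityˡ _)
  ... | no i≢1+m = trans (+-cong (sum≤-single m i f (ℕ.≤-pred (ℕ.≤∧≢⇒< i≤ i≢1+m))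
                                    λ j j≤m → f≈0 j (ℕ.m≤n⇒m≤1+n j≤m))
                                 (f≈0 (suc m) ℕ.≤-refl λ e → i≢1+m (≡.sym e)))
                   (+-identityʳ _)

  sum≤-swap : ∀ m (F : ℕ → ℕ → Carrier) →
    sum≤ m (λ j → sum≤ j (λ i → F i j)) ≈ sum≤ m (λ i → sum≤ (m ∸ i) (λ l → F i (i ℕ.+ l)))
  sum≤-swap zero    F = refl
  sum≤-swap (suc m) F = sym (begin
    sum≤ (suc m) (λ i → sum≤ (suc m ∸ i) (λ l → F i (i ℕ.+ l)))
      ≈⟨ +-cong (sum≤-cong m last-column) last-row ⟩
    sum≤ m (λ i → sum≤ (m ∸ i) (λ l → F i (i ℕ.+ l)) + F i (suc m)) + F (suc m) (suc m)
      ≈⟨ +-congʳ (sum≤-distrib-+ m _ _) ⟩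
    (sum≤ m (λ i → sum≤ (m ∸ i) (λ l → F i (i ℕ.+ l))) + sum≤ m (λ i → F i (suc m)))
        + F (suc m) (suc m)
      ≈⟨ +-assoc _ _ _ ⟩
    sum≤ m (λ i → sum≤ (m ∸ i) (λ l → F i (i ℕ.+ l))) + sum≤ (suc m) (λ i → F i (suc m))
      ≈⟨ +-congʳ (sum≤-swap m F) ⟨
    sum≤ m (λ j → sum≤ j (λ i → F i j)) + sum≤ (suc m) (λ i → F i (suc m)) ∎)
    where
    last-row : sum≤ (suc m ∸ suc m) (λ l → F (suc m) (suc m ℕ.+ l)) ≈ F (suc m) (suc m)
    last-row rewrite ℕ.n∸n≡0 m | ℕ.+-identityʳ m = refl

    last-column : ∀ i → i ≤ m →
      sum≤ (suc m ∸ i) (λ l → F i (i ℕ.+ l)) ≈ sum≤ (m ∸ i) (λ l → F i (i ℕ.+ l)) + F i (suc m)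
    last-column i i≤m rewrite ℕ.+-∸-assoc 1 i≤m | ℕ.+-suc i (m ∸ i) | ℕ.m+[n∸m]≡n i≤m = refl

-- Sequences under the Cauchy product

module SequenceRing {c ℓ} (R : CommutativeRing c ℓ) where
  open CommutativeRing R hiding (zero)
  open SumsOver commutativeSemiring public
  open import Relation.Binary.Reasoning.Setoid setoid

  Seq : Set c
  Seq = ℕ → Carrier

  infixl 6 _⊕_
  infixl 7 _⊛_

  _⊕_ : Seq → Seq → Seq
  (f ⊕ g) m = f m + g m

  ⊝_ : Seq → Seq
  (⊝ f) m = - f m

  𝟎 : Seq
  𝟎 _ = 0#

  𝟏 : Seq
  𝟏 zero    = 1#
  𝟏 (suc _) = 0#

  _⊛_ : Seq → Seq → Seq
  (f ⊛ g) m = sum≤ m (λ j → f j * g (m ∸ j))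

  ⊛-comm : ∀ f g m → (f ⊛ g) m ≈ (g ⊛ f) m
  ⊛-comm f g m = trans (sum≤-reverse m _) (sum≤-cong m λ j j≤m →
    trans (*-comm _ _) (*-congʳ (reflexive (≡.cong g (ℕ.m∸[m∸n]≡n j≤m)))))

  ⊛-assoc : ∀ f g h m → ((f ⊛ g) ⊛ h) m ≈ (f ⊛ (g ⊛ h)) m
  ⊛-assoc f g h m = begin
    sum≤ m (λ j → sum≤ j (λ i → f i * g (j ∸ i)) * h (m ∸ j))
      ≈⟨ sum≤-cong m (λ j _ → *-distribʳ-sum≤ j _ _) ⟩
    sum≤ m (λ j → sum≤ j (λ i → f i * g (j ∸ i) * h (m ∸ j)))
      ≈⟨ sum≤-swap m (λ i j → f i * g (j ∸ i) * h (m ∸ j)) ⟩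
    sum≤ m (λ i → sum≤ (m ∸ i) (λ l → f i * g ((i ℕ.+ l) ∸ i) * h (m ∸ (i ℕ.+ l))))
      ≈⟨ sum≤-cong m (λ i _ → sum≤-cong (m ∸ i) λ l _ → trans (*-assoc _ _ _)
           (*-congˡ (*-cong (reflexive (≡.cong g (ℕ.m+n∸m≡n i l)))
                            (reflexive (≡.cong h (≡.sym (ℕ.∸-+-assoc m i l))))))) ⟩
    sum≤ m (λ i → sum≤ (m ∸ i) (λ l → f i * (g l * h ((m ∸ i) ∸ l))))
      ≈⟨ sum≤-cong m (λ i _ → *-distribˡ-sum≤ (m ∸ i) _ _) ⟨
    sum≤ m (λ i → f i * sum≤ (m ∸ i) (λ l → g l * h ((m ∸ i) ∸ l))) ∎

  ⊛-distribˡ-⊕ : ∀ f g h m → (f ⊛ (g ⊕ h)) m ≈ (f ⊛ g ⊕ f ⊛ h) m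
  ⊛-distribˡ-⊕ f g h m = trans (sum≤-cong m λ _ _ → distribˡ _ _ _) (sum≤-distrib-+ m _ _)

  ⊛-identityˡ : ∀ f m → (𝟏 ⊛ f) m ≈ f m
  ⊛-identityˡ f m = trans (sum≤-single m 0 _ z≤n vanish) (*-identityˡ _)
    where
    vanish : ∀ j → j ≤ m → ¬ j ≡ 0 → 𝟏 j * f (m ∸ j) ≈ 0#
    vanish zero    _ j≢0 = ⊥-elim (j≢0 ≡.refl)
    vanish (suc j) _ _   = zeroˡ _

  -- Agreement on a downward closed set B of indices: B = (_≤ N) gives the
  -- ring of power series modulo t^(N+1), B = everything the full ring.
  record AgreeOn (B : ℕ → Set) (f g : Seq) : Set ℓ where
    constructor agreeOn
    field agree : ∀ m → B m → f m ≈ g m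
  open AgreeOn public

  pointwise : ∀ {B f g} → (∀ m → f m ≈ g m) → AgreeOn B f g
  pointwise f≈g = agreeOn λ m _ → f≈g m

  module _ (B : ℕ → Set) (B-down : ∀ {m n} → m ≤ n → B n → B m) where

    ⊛-cong : ∀ {f f' g g'} → AgreeOn B f f' → AgreeOn B g g' → AgreeOn B (f ⊛ g) (f' ⊛ g')
    ⊛-cong (agreeOn f≈f') (agreeOn g≈g') = agreeOn λ m Bm → sum≤-cong m λ j j≤m →
      *-cong (f≈f' j (B-down j≤m Bm)) (g≈g' (m ∸ j) (B-down (ℕ.m∸n≤m m j) Bm))

    sequenceRing : CommutativeRing c ℓ
    sequenceRing = record
      { Carrier = Seq ; _≈_ = AgreeOn B ; _+_ = _⊕_ ; _*_ = _⊛_ ; -_ = ⊝_ ; 0# = 𝟎 ; 1# = 𝟏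
      ; isCommutativeRing = record
        { isRing = record
          { +-isAbelianGroup = record
            { isGroup = record
              { isMonoid = record
                { isSemigroup = record
                  { isMagma = record
                    { isEquivalence = record
                      { refl  = pointwise λ _ → refl
                      ; sym   = λ (agreeOn e) → agreeOn λ m b → sym (e m b)
                      ; trans = λ (agreeOn e) (agreeOn e') → agreeOn λ m b → trans (e m b) (e' m b) }
                    ; ∙-cong = λ (agreeOn e) (agreeOn e') → agreeOn λ m b → +-cong (e m b) (e' m b) }
                  ; assoc = λ _ _ _ → pointwise λ _ → +-assoc _ _ _ }
                ; identity = (λ _ → pointwise λ _ → +-identityˡ _) , (λ _ → pointwise λ _ → +-identityʳ _) }
              ; inverse = (λ _ → pointwise λ _ → -‿inverseˡ _) , (λ _ → pointwise λ _ → -‿inverseʳ _)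
              ; ⁻¹-cong = λ (agreeOn e) → agreeOn λ m b → -‿cong (e m b) }
            ; comm = λ _ _ → pointwise λ _ → +-comm _ _ }
          ; *-cong = ⊛-cong
          ; *-assoc = λ f g h → pointwise (⊛-assoc f g h)
          ; *-identity = (λ f → pointwise (⊛-identityˡ f))
                       , (λ f → pointwise λ m → trans (⊛-comm f 𝟏 m) (⊛-identityˡ f m))
          ; distrib = (λ f g h → pointwise (⊛-distribˡ-⊕ f g h))
                    , (λ f g h → pointwise λ m → trans (⊛-comm (g ⊕ h) f m)
                         (trans (⊛-distribˡ-⊕ f g h m) (+-cong (⊛-comm f g m) (⊛-comm f h m)))) }
        ; *-comm = λ f g → pointwise (⊛-comm f g) } }

module ℤCoefficientSolver {c ℓ} (R : CommutativeRing c ℓ)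
  (embed : CommutativeRing.rawRing ℤ.+-*-commutativeRing
             -Raw-AlmostCommutative⟶ fromCommutativeRing R) where
  open CommutativeRing R using (_≈_; refl)
  open _-Raw-AlmostCommutative⟶_ embed using (⟦_⟧)

  private
    ⟦⟧-≟ : ∀ a b → Maybe (⟦ a ⟧ ≈ ⟦ b ⟧)
    ⟦⟧-≟ a b with a ℤ.≟ b
    ... | yes ≡.refl = just refl
    ... | no _       = nothing

  open import Algebra.Solver.Ring _ _ embed ⟦⟧-≟ public

-- ℤ[X] as a commutative ring

module ℤ[[X]] = SequenceRing ℤ.+-*-commutativeRing

coeff-+ : ∀ p q k → coeff (p +ₚ q) k ≡ coeff p k ℤ.+ coeff q k
coeff-+ []      q       k       = ≡.sym (ℤ.+-identityˡ _)
coeff-+ (a ∷ p) []      k       = ≡.sym (ℤ.+-identityʳ _)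
coeff-+ (a ∷ p) (b ∷ q) zero    = ≡.refl
coeff-+ (a ∷ p) (b ∷ q) (suc k) = coeff-+ p q k

coeff-neg : ∀ p k → coeff (negₚ p) k ≡ ℤ.- coeff p k
coeff-neg []      k       = ≡.refl
coeff-neg (a ∷ p) zero    = ≡.refl
coeff-neg (a ∷ p) (suc k) = coeff-neg p k

coeff-scale : ∀ a p k → coeff (scaleₚ a p) k ≡ a ℤ.* coeff p k
coeff-scale a []      k       = ≡.sym (ℤ.*-zeroʳ a)
coeff-scale a (b ∷ p) zero    = ≡.refl
coeff-scale a (b ∷ p) (suc k) = coeff-scale a p k

coeff-* : ∀ p q k → coeff (p *ₚ q) k ≡ (coeff p ℤ[[X]].⊛ coeff q) k
coeff-* []      q k       = ≡.sym (ℤ[[X]].sum≤-zero k λ j _ → ℤ.*-zeroˡ (coeff q (k ∸ j)))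
coeff-* (a ∷ p) q zero    =
  ≡.trans (coeff-+ (scaleₚ a q) _ 0) (≡.trans (ℤ.+-identityʳ _) (coeff-scale a q 0))
coeff-* (a ∷ p) q (suc k) = ≡.trans (coeff-+ (scaleₚ a q) _ (suc k))
  (≡.trans (≡.cong₂ ℤ._+_ (coeff-scale a q (suc k)) (coeff-* p q k)) (≡.sym (ℤ[[X]].sum≤-suc-first k _)))

infix 4 _≐_
record _≐_ (p q : Poly) : Set where
  constructor mk≐
  field coeff-≡ : ∀ k → coeff p k ≡ coeff q k
open _≐_ public

polyRing : CommutativeRing _ _
polyRing = record
  { Carrier = Poly ; _≈_ = _≐_ ; _+_ = _+ₚ_ ; _*_ = _*ₚ_ ; -_ = negₚ ; 0# = [] ; 1# = const 1ℤ
  ; isCommutativeRing = RingMonomorphism.isCommutativeRing coeff-isRingMonomorphism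
      (CommutativeRing.isCommutativeRing powerSeriesRing) }
  where
  powerSeriesRing : CommutativeRing _ _
  powerSeriesRing = ℤ[[X]].sequenceRing (λ _ → ⊤) (λ _ _ → tt)

  coeff-isRingMonomorphism : IsRingMonomorphism _ (CommutativeRing.rawRing powerSeriesRing) coeff
  coeff-isRingMonomorphism = record
    { isRingHomomorphism = record
      { isSemiringHomomorphism = record
        { isNearSemiringHomomorphism = record
          { +-isMonoidHomomorphism = record
            { isMagmaHomomorphism = record
              { isRelHomomorphism = record { cong = λ (mk≐ e) → ℤ[[X]].agreeOn λ k _ → e k }
              ; homo = λ p q → ℤ[[X]].agreeOn λ k _ → coeff-+ p q k }
            ; ε-homo = ℤ[[X]].agreeOn λ _ _ → ≡.refl }
          ; *-homo = λ p q → ℤ[[X]].agreeOn λ k _ → coeff-* p q k }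
        ; 1#-homo = ℤ[[X]].agreeOn λ { zero _ → ≡.refl ; (suc _) _ → ≡.refl } }
      ; -‿homo = λ p → ℤ[[X]].agreeOn λ k _ → coeff-neg p k }
    ; injective = λ (ℤ[[X]].agreeOn e) → mk≐ λ k → e k tt }

module P = CommutativeRing polyRing

const-embedding : CommutativeRing.rawRing ℤ.+-*-commutativeRing
                    -Raw-AlmostCommutative⟶ fromCommutativeRing polyRing
const-embedding = record
  { ⟦_⟧    = const
  ; +-homo = λ _ _ → P.refl
  ; *-homo = λ _ _ → mk≐ λ { zero → ≡.sym (ℤ.+-identityʳ _) ; (suc _) → ≡.refl }
  ; -‿homo = λ _ → P.refl
  ; 0-homo = mk≐ λ { zero → ≡.refl ; (suc _) → ≡.refl }
  ; 1-homo = P.refl }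

module PolySolver = ℤCoefficientSolver polyRing const-embedding

coeff-- : ∀ p q k → coeff (p -ₚ q) k ≡ coeff p k ℤ.- coeff q k
coeff-- p q k = ≡.trans (coeff-+ p (negₚ q) k) (≡.cong (λ x → coeff p k ℤ.+ x) (coeff-neg q k))

coeff-const* : ∀ a p k → coeff (const a *ₚ p) k ≡ a ℤ.* coeff p k
coeff-const* a p k = ≡.trans (coeff-+ (scaleₚ a p) (0ℤ ∷ []) k)
  (≡.trans (≡.cong (λ x → coeff (scaleₚ a p) k ℤ.+ x) (coeff-0∷[] k))
         (≡.trans (ℤ.+-identityʳ _) (coeff-scale a p k)))
  where
  coeff-0∷[] : ∀ k → coeff (0ℤ ∷ []) k ≡ 0ℤ
  coeff-0∷[] zero    = ≡.refl
  coeff-0∷[] (suc _) = ≡.refl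

Xₚ*-shift : ∀ p → Xₚ *ₚ p ≐ 0ℤ ∷ p
Xₚ*-shift p = mk≐ λ
  { zero    → ≡.trans (coeff-+ (scaleₚ 0ℤ p) _ 0) (≡.trans (ℤ.+-identityʳ _) (coeff-scale 0ℤ p 0))
  ; (suc k) → ≡.trans (coeff-+ (scaleₚ 0ℤ p) _ (suc k))
      (≡.trans (≡.cong₂ ℤ._+_ (coeff-scale 0ℤ p (suc k)) (coeff-≡ (P.*-identityˡ p) k)) (ℤ.+-identityˡ _)) }

∷-expand : ∀ a p → a ∷ p ≐ const a +ₚ Xₚ *ₚ p
∷-expand a p = P.trans (mk≐ λ { zero → ≡.sym (ℤ.+-identityʳ a) ; (suc k) → ≡.refl })
                       (P.+-congˡ {const a} (P.sym (Xₚ*-shift p)))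

coeff-beyond-length : ∀ p k → length p ≤ k → coeff p k ≡ 0ℤ
coeff-beyond-length []      k       _         = ≡.refl
coeff-beyond-length (a ∷ p) (suc k) (s≤s len) = coeff-beyond-length p k len

-- Division by X − 2

X-2 : Poly
X-2 = Xₚ -ₚ const (+ 2)

divX-2-spec : ∀ p → p ≐ X-2 *ₚ proj₁ (divX-2 p) +ₚ const (proj₂ (divX-2 p))
divX-2-spec []      = mk≐ λ { zero → ≡.refl ; (suc zero) → ≡.refl ; (suc (suc _)) → ≡.refl }
divX-2-spec (a ∷ p) with divX-2 p | divX-2-spec p
... | q , r | p≐ = begin
  a ∷ p
    ≈⟨ ∷-expand a p ⟩
  const a +ₚ Xₚ *ₚ p
    ≈⟨ P.+-congˡ {const a} (P.*-congˡ {Xₚ} p≐) ⟩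
  const a +ₚ Xₚ *ₚ (X-2 *ₚ q +ₚ const r)
    ≈⟨ solve 4 (λ x a q r → a :+ x :* ((x :- con (+ 2)) :* q :+ r)
                  := (x :- con (+ 2)) :* (r :+ x :* q) :+ (a :+ con (+ 2) :* r))
             P.refl Xₚ (const a) q (const r) ⟩
  X-2 *ₚ (const r +ₚ Xₚ *ₚ q) +ₚ (const a +ₚ const (+ 2) *ₚ const r)
    ≈⟨ P.+-cong (P.*-congˡ {X-2} (P.sym (∷-expand r q)))
                (P.sym (P.trans (+-homo a (+ 2 ℤ.* r)) (P.+-congˡ {const a} (*-homo (+ 2) r)))) ⟩
  X-2 *ₚ (r ∷ q) +ₚ const (a ℤ.+ + 2 ℤ.* r) ∎
  where
  open import Relation.Binary.Reasoning.Setoid P.setoid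
  open PolySolver
  open Algebra.Solver.Ring.AlmostCommutativeRing._-Raw-AlmostCommutative⟶_ const-embedding
    using (+-homo; *-homo)

coeff-X-2* : ∀ p k → coeff (X-2 *ₚ p) (suc k) ≡ coeff p k ℤ.- + 2 ℤ.* coeff p (suc k)
coeff-X-2* p k = begin
  coeff (X-2 *ₚ p) (suc k)
    ≡⟨ coeff-≡ (solve 2 (λ x p → (x :- con (+ 2)) :* p := x :* p :- con (+ 2) :* p) P.refl Xₚ p) (suc k) ⟩
  coeff (Xₚ *ₚ p -ₚ const (+ 2) *ₚ p) (suc k)
    ≡⟨ coeff-- (Xₚ *ₚ p) _ (suc k) ⟩
  coeff (Xₚ *ₚ p) (suc k) ℤ.- coeff (const (+ 2) *ₚ p) (suc k)
    ≡⟨ ≡.cong₂ ℤ._-_ (coeff-≡ (Xₚ*-shift p) (suc k)) (coeff-const* (+ 2) p (suc k)) ⟩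
  coeff p k ℤ.- + 2 ℤ.* coeff p (suc k) ∎
  where
  open ≡.≡-Reasoning
  open PolySolver

-- From the top coefficient down: pⱼ = 2 pⱼ₊₁ = 0.
coeff-X-2*≡0⇒coeff≡0 : ∀ p (U : ℕ → Set) → (∀ {j} → U j → U (suc j)) →
  (∀ j → U j → coeff (X-2 *ₚ p) (suc j) ≡ 0ℤ) → ∀ j → U j → coeff p j ≡ 0ℤ
coeff-X-2*≡0⇒coeff≡0 p U U-up vanishes j Uj = descend (length p) j (ℕ.m≤n+m _ j) Uj
  where
  descend : ∀ d j → length p ≤ j ℕ.+ d → U j → coeff p j ≡ 0ℤ
  descend zero    j len _  = coeff-beyond-length p j (≡.subst (length p ≤_) (ℕ.+-identityʳ j) len)
  descend (suc d) j len Uj = begin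
    coeff p j
      ≡⟨ ℤ.i-j≡0⇒i≡j _ _ (≡.trans (≡.sym (coeff-X-2* p j)) (vanishes j Uj)) ⟩
    + 2 ℤ.* coeff p (suc j)
      ≡⟨ ≡.cong (+ 2 ℤ.*_) (descend d (suc j) (≡.subst (length p ≤_) (ℕ.+-suc j d) len) (U-up Uj)) ⟩
    + 2 ℤ.* 0ℤ
      ≡⟨ ℤ.*-zeroʳ (+ 2) ⟩
    0ℤ ∎
    where open ≡.≡-Reasoning

-- Power series over ℤ[X] modulo tᴺ⁺¹

monoₛ-at : ∀ i c → monoₛ i c i ≡ c
monoₛ-at i c with i ≡ᵇ i | ℕ.≡⇒≡ᵇ i i ≡.refl
... | true | _ = ≡.refl

monoₛ-off : ∀ i c m → m ≢ i → monoₛ i c m ≡ []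
monoₛ-off i c m m≢i with m ≡ᵇ i | ℕ.≡ᵇ⇒≡ m i
... | false | _    = ≡.refl
... | true  | m≡i  = ⊥-elim (m≢i (m≡i tt))

coeff-monoₛ-off : ∀ i a m k → m ≢ i → coeff (monoₛ i a m) k ≡ 0ℤ
coeff-monoₛ-off i a m k m≢i = ≡.cong (λ p → coeff p k) (monoₛ-off i a m m≢i)

coeff-monoₛ : ∀ i {a} m k → coeff a k ≡ 0ℤ → coeff (monoₛ i a m) k ≡ 0ℤ
coeff-monoₛ i m k aₖ≡0 with m ≡ᵇ i
... | true  = aₖ≡0
... | false = ≡.refl

module Truncated (N : ℕ) where
  open SequenceRing polyRing public
    using (agreeOn; agree; pointwise; sum≤; sum≤-single; sum≤-zero)

  ℤ[X][[t]]/tᴺ⁺¹ : CommutativeRing _ _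
  ℤ[X][[t]]/tᴺ⁺¹ = sequenceRing (_≤ N) ℕ.≤-trans
    where open SequenceRing polyRing using (sequenceRing)

  open CommutativeRing ℤ[X][[t]]/tᴺ⁺¹ public hiding (zero)
  open import Relation.Binary.Reasoning.Setoid setoid

  Σ≤≡sum≤ : ∀ m f → Σ≤ m f ≡ sum≤ m f
  Σ≤≡sum≤ zero    f = ≡.refl
  Σ≤≡sum≤ (suc m) f = ≡.cong (_+ₚ f (suc m)) (Σ≤≡sum≤ m f)

  *ₛ≈* : ∀ f g → f *ₛ g ≈ f * g
  *ₛ≈* f g = pointwise λ m → P.reflexive (Σ≤≡sum≤ m _)

  constₛ : ℤ → Series
  constₛ a zero    = const a
  constₛ a (suc _) = []

  𝟙 : Series
  𝟙 = constₛ 1ℤ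

  oneₛ≈𝟙 : oneₛ ≈ 𝟙
  oneₛ≈𝟙 = pointwise λ { zero → P.refl ; (suc _) → P.refl }

  constₛ-embedding : CommutativeRing.rawRing ℤ.+-*-commutativeRing
                       -Raw-AlmostCommutative⟶ fromCommutativeRing ℤ[X][[t]]/tᴺ⁺¹
  constₛ-embedding = record
    { ⟦_⟧    = constₛ
    ; +-homo = λ _ _ → pointwise λ { zero → P.refl ; (suc _) → P.refl }
    ; *-homo = λ a b → pointwise λ
        { zero    → *-homo a b
        ; (suc m) → P.sym (sum≤-zero (suc m) λ { zero _ → P.zeroʳ (const a) ; (suc _) _ → P.refl }) }
    ; -‿homo = λ _ → pointwise λ { zero → P.refl ; (suc _) → P.refl }
    ; 0-homo = pointwise λ { zero → 0-homo ; (suc _) → P.refl }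
    ; 1-homo = pointwise λ { zero → P.refl ; (suc _) → P.refl } }
    where open _-Raw-AlmostCommutative⟶_ const-embedding using (*-homo; 0-homo)

  open ℤCoefficientSolver ℤ[X][[t]]/tᴺ⁺¹ constₛ-embedding
    public using (solve; _:+_; _:-_; _:*_; :-_; con; _:=_)

  monoₛ-*-≥ : ∀ i a f m → i ≤ m → (monoₛ i a * f) m ≐ a *ₚ f (m ∸ i)
  monoₛ-*-≥ i a f m i≤m = P.trans (sum≤-single m i _ i≤m vanish)
    (P.reflexive (≡.cong (_*ₚ f (m ∸ i)) (monoₛ-at i a)))
    where
    vanish : ∀ j → j ≤ m → j ≢ i → monoₛ i a j *ₚ f (m ∸ j) ≐ []
    vanish j _ j≢i = P.reflexive (≡.cong (_*ₚ f (m ∸ j)) (monoₛ-off i a j j≢i))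

  monoₛ-*-< : ∀ i a f m → m < i → (monoₛ i a * f) m ≐ []
  monoₛ-*-< i a f m m<i = sum≤-zero m λ j j≤m →
    P.reflexive (≡.cong (_*ₚ f (m ∸ j)) (monoₛ-off i a j (ℕ.<⇒≢ (ℕ.≤-<-trans j≤m m<i))))

  monoₛ-*-monoₛ : ∀ i j a b → monoₛ i a * monoₛ j b ≈ monoₛ (i ℕ.+ j) (a *ₚ b)
  monoₛ-*-monoₛ i j a b = pointwise product
    where
    product : ∀ m → (monoₛ i a * monoₛ j b) m ≐ monoₛ (i ℕ.+ j) (a *ₚ b) m
    product m with i ℕ.≤? m
    ... | no i≰m = P.trans (monoₛ-*-< i a (monoₛ j b) m (ℕ.≰⇒> i≰m)) (P.reflexive (≡.sym
                     (monoₛ-off (i ℕ.+ j) _ m λ { ≡.refl → i≰m (ℕ.m≤m+n i j) })))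
    ... | yes i≤m with m ∸ i ℕ.≟ j
    ...   | yes ≡.refl = P.trans (monoₛ-*-≥ i a (monoₛ j b) m i≤m) (P.reflexive (≡.trans
              (≡.cong (a *ₚ_) (monoₛ-at (m ∸ i) b))
              (≡.sym (≡.subst (λ n → monoₛ n (a *ₚ b) m ≡ a *ₚ b)
                              (≡.sym (ℕ.m+[n∸m]≡n i≤m)) (monoₛ-at m (a *ₚ b))))))
    ...   | no m∸i≢j = P.trans (monoₛ-*-≥ i a (monoₛ j b) m i≤m) (P.trans
              (P.reflexive (≡.cong (a *ₚ_) (monoₛ-off j b (m ∸ i) m∸i≢j)))
              (P.trans (P.zeroʳ a) (P.reflexive (≡.sym (monoₛ-off (i ℕ.+ j) _ m
                λ { ≡.refl → m∸i≢j (ℕ.m+n∸m≡n i j) })))))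

  monoₛ-cong : ∀ i {a b} → a ≐ b → monoₛ i a ≈ monoₛ i b
  monoₛ-cong i {a} {b} a≐b = pointwise pick
    where
    pick : ∀ m → monoₛ i a m ≐ monoₛ i b m
    pick m with m ≡ᵇ i
    ... | true  = a≐b
    ... | false = P.refl

  t^ : ℕ → Series
  t^ i = monoₛ i (const 1ℤ)

  t : Series
  t = t^ 1

  X : Series
  X = monoₛ 0 Xₚ

  t^-+ : ∀ i j → t^ (i ℕ.+ j) ≈ t^ i * t^ j
  t^-+ i j = sym (trans (monoₛ-*-monoₛ i j _ _) (monoₛ-cong (i ℕ.+ j) (P.*-identityˡ _)))

  t^-suc : ∀ i → t^ (suc i) ≈ t^ i * t
  t^-suc i = trans (reflexive (≡.cong t^ (ℕ.+-comm 1 i))) (t^-+ i 1)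

  t^-double : ∀ i → t^ (2 ℕ.* i) ≈ t^ i * t^ i
  t^-double i = trans (reflexive (≡.cong (λ n → t^ (i ℕ.+ n)) (ℕ.+-identityʳ i))) (t^-+ i i)

  Xt^ : ∀ i → monoₛ i Xₚ ≈ X * t^ i
  Xt^ i = sym (trans (monoₛ-*-monoₛ 0 i _ _) (monoₛ-cong i (P.*-identityʳ _)))

  powₛ-vanish : ∀ u → u 0 ≐ [] → ∀ k m → m < k → powₛ u k m ≐ []
  powₛ-vanish u u₀≐0 (suc k) m m<k = P.trans (P.reflexive (Σ≤≡sum≤ m _)) (sum≤-zero m term)
    where
    term : ∀ j → j ≤ m → u j *ₚ powₛ u k (m ∸ j) ≐ []
    term zero    _   = P.trans (P.*-congʳ {powₛ u k m} u₀≐0) (P.zeroˡ (powₛ u k m))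
    term (suc j) j<m = P.trans (P.*-congˡ {u (suc j)} (powₛ-vanish u u₀≐0 k (m ∸ suc j)
                         (ℕ.<-≤-trans (ℕ.∸-monoʳ-< (s≤s z≤n) j<m) (ℕ.≤-pred m<k))))
                       (P.zeroʳ (u (suc j)))

  geomₛ-telescope : ∀ u K → (𝟙 - u) * geomₛ K u ≈ 𝟙 - powₛ u (suc K)
  geomₛ-telescope u zero = begin
    (𝟙 - u) * oneₛ   ≈⟨ *-congˡ {𝟙 - u} oneₛ≈𝟙 ⟩
    (𝟙 - u) * 𝟙      ≈⟨ solve 1 (λ u → (con 1ℤ :- u) :* con 1ℤ := con 1ℤ :- u :* con 1ℤ) refl u ⟩
    𝟙 - u * 𝟙        ≈⟨ +-congˡ (-‿cong (trans (*-congˡ {u} (sym oneₛ≈𝟙)) (sym (*ₛ≈* u oneₛ)))) ⟩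
    𝟙 - powₛ u 1     ∎
  geomₛ-telescope u (suc K) = begin
    (𝟙 - u) * (geomₛ K u + uᴷ⁺¹)
      ≈⟨ solve 3 (λ u G P → (con 1ℤ :- u) :* (G :+ P) := (con 1ℤ :- u) :* G :+ P :- u :* P)
               refl u (geomₛ K u) uᴷ⁺¹ ⟩
    (𝟙 - u) * geomₛ K u + uᴷ⁺¹ - u * uᴷ⁺¹
      ≈⟨ +-congʳ (+-congʳ (geomₛ-telescope u K)) ⟩
    𝟙 - uᴷ⁺¹ + uᴷ⁺¹ - u * uᴷ⁺¹
      ≈⟨ solve 3 (λ o P Q → o :- P :+ P :- Q := o :- Q) refl 𝟙 uᴷ⁺¹ (u * uᴷ⁺¹) ⟩
    𝟙 - u * uᴷ⁺¹
      ≈⟨ +-congˡ (-‿cong (*ₛ≈* u uᴷ⁺¹)) ⟨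
    𝟙 - powₛ u (suc (suc K)) ∎
    where uᴷ⁺¹ = powₛ u (suc K)

  geomₛ-inverse : ∀ u → u 0 ≐ [] → (𝟙 - u) * geomₛ N u ≈ 𝟙
  geomₛ-inverse u u₀≐0 = trans (geomₛ-telescope u N) (agreeOn λ m m≤N →
    P.trans (P.+-congˡ (P.-‿cong (powₛ-vanish u u₀≐0 (suc N) m (s≤s m≤N)))) (P.+-identityʳ _))

  coeff-sum≤-zero : ∀ m h k → (∀ j → j ≤ m → coeff (h j) k ≡ 0ℤ) → coeff (sum≤ m h) k ≡ 0ℤ
  coeff-sum≤-zero zero    h k h≡0 = h≡0 zero z≤n
  coeff-sum≤-zero (suc m) h k h≡0 = ≡.trans (coeff-+ (sum≤ m h) (h (suc m)) k)
    (≡.cong₂ ℤ._+_ (coeff-sum≤-zero m h k λ j j≤m → h≡0 j (ℕ.m≤n⇒m≤1+n j≤m)) (h≡0 (suc m) ℕ.≤-refl))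

  record Order≥ (c r : ℕ) (f : Series) : Set where
    constructor order≥
    field vanish : ∀ m k → m ≤ N → m < c ℕ.* k ℕ.+ r → coeff (f m) k ≡ 0ℤ
  open Order≥ public

  Order≥-zero : ∀ {c r} → Order≥ c r 0#
  Order≥-zero = order≥ λ _ _ _ _ → ≡.refl

  module _ {c : ℕ} where

    Order≥-resp : ∀ {r f g} → f ≈ g → Order≥ c r f → Order≥ c r g
    Order≥-resp (agreeOn f≈g) (order≥ ord) = order≥ λ m k m≤N m< →
      ≡.trans (≡.sym (coeff-≡ (f≈g m m≤N) k)) (ord m k m≤N m<)

    Order≥-+ : ∀ {r f g} → Order≥ c r f → Order≥ c r g → Order≥ c r (f + g)
    Order≥-+ {f = f} {g} (order≥ ord-f) (order≥ ord-g) = order≥ λ m k m≤N m< →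
      ≡.trans (coeff-+ (f m) (g m) k) (≡.cong₂ ℤ._+_ (ord-f m k m≤N m<) (ord-g m k m≤N m<))

    Order≥-neg : ∀ {r f} → Order≥ c r f → Order≥ c r (- f)
    Order≥-neg {f = f} (order≥ ord) = order≥ λ m k m≤N m< →
      ≡.trans (coeff-neg (f m) k) (≡.cong ℤ.-_ (ord m k m≤N m<))

    Order≥-- : ∀ {r f g} → Order≥ c r f → Order≥ c r g → Order≥ c r (f - g)
    Order≥-- ord-f ord-g = Order≥-+ ord-f (Order≥-neg ord-g)

    Order≥-* : ∀ {r r' f g} → Order≥ c r f → Order≥ c r' g → Order≥ c (r ℕ.+ r') (f * g)
    Order≥-* {r} {r'} {f} {g} (order≥ ord-f) (order≥ ord-g) = order≥ λ m k m≤N m< →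
      coeff-sum≤-zero m _ k λ j j≤m → ≡.trans (coeff-* (f j) (g (m ∸ j)) k)
        (ℤ[[X]].sum≤-zero k λ i i≤k → term m k m≤N m< j i j≤m i≤k)
      where
      term : ∀ m k → m ≤ N → m < c ℕ.* k ℕ.+ (r ℕ.+ r') → ∀ j i → j ≤ m → i ≤ k →
             coeff (f j) i ℤ.* coeff (g (m ∸ j)) (k ∸ i) ≡ 0ℤ
      term m k m≤N m< j i j≤m i≤k with j ℕ.<? c ℕ.* i ℕ.+ r
      ... | yes j< = ≡.cong (ℤ._* coeff (g (m ∸ j)) (k ∸ i)) (ord-f j i (ℕ.≤-trans j≤m m≤N) j<)
      ... | no j≮ = ≡.trans (≡.cong (coeff (f j) i ℤ.*_)
                              (ord-g (m ∸ j) (k ∸ i) (ℕ.≤-trans (ℕ.m∸n≤m m j) m≤N) m∸j<))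
                            (ℤ.*-zeroʳ (coeff (f j) i))
        where
        +-*-regroup : ∀ c i d r r' → c ℕ.* (i ℕ.+ d) ℕ.+ (r ℕ.+ r') ≡ (c ℕ.* i ℕ.+ r) ℕ.+ (c ℕ.* d ℕ.+ r')
        +-*-regroup = solve-∀
        split : c ℕ.* k ℕ.+ (r ℕ.+ r') ≡ (c ℕ.* i ℕ.+ r) ℕ.+ (c ℕ.* (k ∸ i) ℕ.+ r')
        split = ≡.trans (≡.cong (λ n → c ℕ.* n ℕ.+ (r ℕ.+ r')) (≡.sym (ℕ.m+[n∸m]≡n i≤k)))
                        (+-*-regroup c i (k ∸ i) r r')
        m∸j< : m ∸ j < c ℕ.* (k ∸ i) ℕ.+ r'
        m∸j< = ≡.subst (m ∸ j <_) (ℕ.m+n∸m≡n j _) (ℕ.∸-monoˡ-<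
          (ℕ.<-≤-trans m< (ℕ.≤-trans (ℕ.≤-reflexive split) (ℕ.+-monoˡ-≤ _ (ℕ.≮⇒≥ j≮))))
          j≤m)

    Order≥-weaken : ∀ {r c' r' f} → c' ≤ c → r' ≤ r → Order≥ c r f → Order≥ c' r' f
    Order≥-weaken c'≤c r'≤r (order≥ ord) = order≥ λ m k m≤N m< →
      ord m k m≤N (ℕ.<-≤-trans m< (ℕ.+-mono-≤ (ℕ.*-monoˡ-≤ _ c'≤c) r'≤r))

    Order≥-constₛ : ∀ a → Order≥ c 0 (constₛ a)
    Order≥-constₛ a = order≥ vanishing
      where
      vanishing : ∀ m k → m ≤ N → m < c ℕ.* k ℕ.+ 0 → coeff (constₛ a m) k ≡ 0ℤ
      vanishing zero    zero    _ 0<c·0+0 =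
        ⊥-elim (ℕ.n≮0 (≡.subst (0 <_) (≡.trans (ℕ.+-identityʳ _) (ℕ.*-zeroʳ c)) 0<c·0+0))
      vanishing zero    (suc k) _ _ = ≡.refl
      vanishing (suc m) k       _ _ = ≡.refl

    Order≥-t^ : ∀ {r} i → r ≤ i → Order≥ c r (t^ i)
    Order≥-t^ {r} i r≤i = order≥ vanishing
      where
      vanishing : ∀ m k → m ≤ N → m < c ℕ.* k ℕ.+ r → coeff (t^ i m) k ≡ 0ℤ
      vanishing m zero    _ m<c·0+r = coeff-monoₛ-off i (const 1ℤ) m 0 λ { ≡.refl →
        ℕ.<⇒≱ (≡.subst (m <_) (≡.cong (ℕ._+ r) (ℕ.*-zeroʳ c)) m<c·0+r) r≤i }
      vanishing m (suc k) _ _ = coeff-monoₛ i m (suc k) ≡.refl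

    Order≥-Xt^ : ∀ i → c ≤ i → Order≥ c 0 (monoₛ i Xₚ)
    Order≥-Xt^ i c≤i = order≥ vanishing
      where
      vanishing : ∀ m k → m ≤ N → m < c ℕ.* k ℕ.+ 0 → coeff (monoₛ i Xₚ m) k ≡ 0ℤ
      vanishing m zero          _ _ = coeff-monoₛ i m 0 ≡.refl
      vanishing m (suc zero)    _ m<c·1+0 = coeff-monoₛ-off i Xₚ m 1 λ { ≡.refl →
        ℕ.<⇒≱ (≡.subst (m <_) (≡.trans (ℕ.+-identityʳ _) (ℕ.*-identityʳ c)) m<c·1+0) c≤i }
      vanishing m (suc (suc k)) _ _ = coeff-monoₛ i m (suc (suc k)) ≡.refl

    Order≥-powₛ : ∀ {u} → Order≥ c 0 u → ∀ k → Order≥ c 0 (powₛ u k)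
    Order≥-powₛ ord zero    = Order≥-resp (sym oneₛ≈𝟙) (Order≥-constₛ 1ℤ)
    Order≥-powₛ {u} ord (suc k) =
      Order≥-resp (sym (*ₛ≈* u (powₛ u k))) (Order≥-* ord (Order≥-powₛ ord k))

    Order≥-geomₛ : ∀ {u} → Order≥ c 0 u → ∀ K → Order≥ c 0 (geomₛ K u)
    Order≥-geomₛ {u} ord K = order≥ λ m k m≤N m< →
      ≡.trans (≡.cong (λ p → coeff p k) (Σ≤≡sum≤ K _))
              (coeff-sum≤-zero K _ k λ j _ → vanish (Order≥-powₛ ord j) m k m≤N m<)

-- The product formula

module ProductFormula (N : ℕ) where
  open Truncated N
  open import Relation.Binary.Reasoning.Setoid setoid

  ρ : ℕ → Series
  ρ i = monoₛ i Xₚ -ₛ monoₛ (2 ℕ.* i) (const 1ℤ)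

  ρ-expand : ∀ i → ρ i ≈ X * t^ i - t^ i * t^ i
  ρ-expand i = +-cong (Xt^ i) (-‿cong (t^-double i))

  factorₛ-expand : ∀ i → factorₛ N i ≈ (𝟙 - t^ i) * (𝟙 - t^ i) * geomₛ N (ρ i)
  factorₛ-expand i = begin
    factorₛ N i
      ≈⟨ *ₛ≈* (powₛ O 2) (geomₛ N (ρ i)) ⟩
    O *ₛ (O *ₛ oneₛ) * geomₛ N (ρ i)
      ≈⟨ *-congʳ {geomₛ N (ρ i)}
           (trans (*ₛ≈* O (O *ₛ oneₛ)) (*-cong O≈ (trans (*ₛ≈* O oneₛ) (*-cong O≈ oneₛ≈𝟙)))) ⟩
    (𝟙 - t^ i) * ((𝟙 - t^ i) * 𝟙) * geomₛ N (ρ i)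
      ≈⟨ solve 2 (λ a g → a :* (a :* con 1ℤ) :* g := a :* a :* g) refl (𝟙 - t^ i) (geomₛ N (ρ i)) ⟩
    (𝟙 - t^ i) * (𝟙 - t^ i) * geomₛ N (ρ i) ∎
    where
    O = oneₛ -ₛ t^ i
    O≈ : O ≈ 𝟙 - t^ i
    O≈ = +-congʳ oneₛ≈𝟙

  κ : Series
  κ zero    = const 1ℤ
  κ (suc m) = 𝒯 (suc m)

  κ-generating : (𝟙 - ρ 1) * κ ≈ 𝟙 - t^ 2
  κ-generating = begin
    (𝟙 - ρ 1) * κ
      ≈⟨ solve 3 (λ a b k → (con 1ℤ :- (a :- b)) :* k := k :- a :* k :+ b :* k)
               refl (monoₛ 1 Xₚ) (t^ 2) κ ⟩
    κ - monoₛ 1 Xₚ * κ + t^ 2 * κ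
      ≈⟨ pointwise recurrence ⟩
    𝟙 - t^ 2 ∎
    where
    open PolySolver using ()
      renaming (solve to solveₚ; _:+_ to _⊞_; _:-_ to _⊟_; _:*_ to _⊠_; con to cst; _:=_ to _≔_)

    shifted : ∀ m {a b} → (monoₛ 1 Xₚ * κ) m ≐ a → (t^ 2 * κ) m ≐ b →
              (κ - monoₛ 1 Xₚ * κ + t^ 2 * κ) m ≐ κ m -ₚ a +ₚ b
    shifted m {a} {b} ≐a ≐b = P.+-cong {κ m -ₚ (monoₛ 1 Xₚ * κ) m} {κ m -ₚ a} {(t^ 2 * κ) m} {b}
                                  (P.+-congˡ {κ m} (P.-‿cong ≐a)) ≐b

    recurrence : ∀ m → (κ - monoₛ 1 Xₚ * κ + t^ 2 * κ) m ≐ (𝟙 - t^ 2) m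
    recurrence zero =
      shifted 0 (monoₛ-*-< 1 Xₚ κ 0 (s≤s z≤n)) (monoₛ-*-< 2 (const 1ℤ) κ 0 (s≤s z≤n))
    recurrence (suc zero) = P.trans
      (shifted 1 (monoₛ-*-≥ 1 Xₚ κ 1 (s≤s z≤n)) (monoₛ-*-< 2 (const 1ℤ) κ 1 (s≤s (s≤s z≤n))))
      (mk≐ λ { zero → ≡.refl ; (suc zero) → ≡.refl ; (suc (suc _)) → ≡.refl })
    recurrence (suc (suc zero)) = P.trans
      (shifted 2 (monoₛ-*-≥ 1 Xₚ κ 2 (s≤s z≤n)) (monoₛ-*-≥ 2 (const 1ℤ) κ 2 (s≤s (s≤s z≤n))))
      (mk≐ λ { zero → ≡.refl ; (suc zero) → ≡.refl ; (suc (suc zero)) → ≡.refl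
             ; (suc (suc (suc _))) → ≡.refl })
    recurrence (suc (suc (suc j))) = P.trans
      (shifted (3 ℕ.+ j) (monoₛ-*-≥ 1 Xₚ κ (3 ℕ.+ j) (s≤s z≤n))
                         (monoₛ-*-≥ 2 (const 1ℤ) κ (3 ℕ.+ j) (s≤s (s≤s z≤n))))
      (P.trans (solveₚ 2 (λ a b → (a ⊟ b) ⊟ a ⊞ cst 1ℤ ⊠ b ≔ cst 0ℤ) P.refl
                       (Xₚ *ₚ 𝒯 (2 ℕ.+ j)) (𝒯 (1 ℕ.+ j)))
               (mk≐ λ { zero → ≡.refl ; (suc _) → ≡.refl }))

  -- In fractions, with T = y x:
  --   (1−x)(1−y)/(1−T) · (1−T)²/(1 − z T + T²) − (1−x)(1−T)/(1 − T x)
  --     = −(1−x)(1−T) y (1 − z x + x²) / ((1 − T x)(1 − z T + T²)).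
  factor-step-identity : ∀ x y z s g h →
    (𝟙 - y * x) * s ≈ 𝟙 →
    (𝟙 - (z * (y * x) - y * x * (y * x))) * g ≈ 𝟙 →
    (𝟙 - y * x * x) * h ≈ 𝟙 →
    (𝟙 - x) * (𝟙 - y) * s * ((𝟙 - y * x) * (𝟙 - y * x) * g) - (𝟙 - x) * (𝟙 - y * x) * h
      ≈ - ((𝟙 - x) * (𝟙 - y * x) * y * (𝟙 - (z * x - x * x)) * h * g)
  factor-step-identity x y z s g h s-inv g-inv h-inv = begin
    (𝟙 - x) * (𝟙 - y) * s * ((𝟙 - T) * (𝟙 - T) * g) - (𝟙 - x) * (𝟙 - T) * h
      ≈⟨ solve 6 (λ x y z s g h → let T = y :* x in
           (𝟏 :- x) :* (𝟏 :- y) :* s :* ((𝟏 :- T) :* (𝟏 :- T) :* g) :- (𝟏 :- x) :* (𝟏 :- T) :* h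
           := (𝟏 :- x) :* (𝟏 :- T) :* (𝟏 :- y) :* g :* ((𝟏 :- T) :* s) :- (𝟏 :- x) :* (𝟏 :- T) :* h :* 𝟏)
           refl x y z s g h ⟩
    c * (𝟙 - y) * g * ((𝟙 - T) * s) - c * h * 𝟙
      ≈⟨ +-cong (*-congˡ {c * (𝟙 - y) * g} s-inv) (-‿cong (*-congˡ {c * h} (sym g-inv))) ⟩
    c * (𝟙 - y) * g * 𝟙 - c * h * (B * g)
      ≈⟨ solve 6 (λ x y z s g h → let T = y :* x ; c = (𝟏 :- x) :* (𝟏 :- T) ; B = 𝟏 :- (z :* T :- T :* T) in
           c :* (𝟏 :- y) :* g :* 𝟏 :- c :* h :* (B :* g) := c :* g :* ((𝟏 :- y) :* 𝟏 :- B :* h))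
           refl x y z s g h ⟩
    c * g * ((𝟙 - y) * 𝟙 - B * h)
      ≈⟨ *-congˡ {c * g} (+-congʳ { - (B * h)} (*-congˡ {𝟙 - y} (sym h-inv))) ⟩
    c * g * ((𝟙 - y) * ((𝟙 - T * x) * h) - B * h)
      ≈⟨ solve 6 (λ x y z s g h → let T = y :* x ; c = (𝟏 :- x) :* (𝟏 :- T) ; B = 𝟏 :- (z :* T :- T :* T) in
           c :* g :* ((𝟏 :- y) :* ((𝟏 :- T :* x) :* h) :- B :* h)
           := :- (c :* y :* (𝟏 :- (z :* x :- x :* x)) :* h :* g))
           refl x y z s g h ⟩
    - ((𝟙 - x) * (𝟙 - T) * y * (𝟙 - (z * x - x * x)) * h * g) ∎
    where
    T = y * x
    c = (𝟙 - x) * (𝟙 - T)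
    B = 𝟙 - (z * T - T * T)
    𝟏 = con 1ℤ

  s : ℕ → Series
  s i = geomₛ N (t^ i)

  g : ℕ → Series
  g i = geomₛ N (ρ i)

  s-inverse : ∀ i → (𝟙 - t^ (suc i)) * s (suc i) ≈ 𝟙
  s-inverse i = geomₛ-inverse (t^ (suc i)) P.refl

  g-inverse : ∀ i → (𝟙 - ρ (suc i)) * g (suc i) ≈ 𝟙
  g-inverse i = geomₛ-inverse (ρ (suc i)) P.refl

  u : ℕ → Series
  u k = (𝟙 - t) * (𝟙 - t^ k) * s (suc k)

  E : ℕ → Series
  E k = prodₛ N k - u k * κ

  E-base : E 1 ≈ 0#
  E-base = begin
    oneₛ *ₛ factorₛ N 1 - u 1 * κ
      ≈⟨ +-congʳ (trans (*ₛ≈* oneₛ (factorₛ N 1)) (*-cong oneₛ≈𝟙 (factorₛ-expand 1))) ⟩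
    𝟙 * ((𝟙 - t) * (𝟙 - t) * g 1) - (𝟙 - t) * (𝟙 - t) * s 2 * κ
      ≈⟨ solve 4 (λ a g s κ → con 1ℤ :* (a :* a :* g) :- a :* a :* s :* κ
                              := a :* a :* g :- a :* a :* (s :* κ))
               refl (𝟙 - t) (g 1) (s 2) κ ⟩
    (𝟙 - t) * (𝟙 - t) * g 1 - (𝟙 - t) * (𝟙 - t) * (s 2 * κ)
      ≈⟨ +-congˡ (-‿cong (*-congˡ {(𝟙 - t) * (𝟙 - t)} (sym g₁≈s₂κ))) ⟩
    (𝟙 - t) * (𝟙 - t) * g 1 - (𝟙 - t) * (𝟙 - t) * g 1
      ≈⟨ -‿inverseʳ ((𝟙 - t) * (𝟙 - t) * g 1) ⟩
    0# ∎
    where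
    g₁≈s₂κ : g 1 ≈ s 2 * κ
    g₁≈s₂κ = begin
      g 1                           ≈⟨ solve 1 (λ g → g := g :* con 1ℤ) refl (g 1) ⟩
      g 1 * 𝟙                       ≈⟨ *-congˡ {g 1} (s-inverse 1) ⟨
      g 1 * ((𝟙 - t^ 2) * s 2)      ≈⟨ *-congˡ {g 1} (*-congʳ {s 2} κ-generating) ⟨
      g 1 * ((𝟙 - ρ 1) * κ * s 2)   ≈⟨ solve 4 (λ g a κ s → g :* (a :* κ :* s) := a :* g :* (s :* κ))
                                             refl (g 1) (𝟙 - ρ 1) κ (s 2) ⟩
      (𝟙 - ρ 1) * g 1 * (s 2 * κ)   ≈⟨ *-congʳ {s 2 * κ} (g-inverse 0) ⟩
      𝟙 * (s 2 * κ)                 ≈⟨ solve 1 (λ a → con 1ℤ :* a := a) refl (s 2 * κ) ⟩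
      s 2 * κ                       ∎

  -- tᵏ comes last so that the orders added up in Δ-order reduce to k by computation.
  Δ : ℕ → Series
  Δ k = (𝟙 - t) * ((𝟙 - t^ 2) * ((𝟙 - t^ k * t) * (s (2 ℕ.+ k) * (g (suc k) * t^ k))))

  E-step : ∀ k → E (suc k) ≈ E k * factorₛ N (suc k) - Δ k
  E-step k = begin
    prodₛ N k *ₛ Fₖ - u (suc k) * κ
      ≈⟨ +-congʳ (*ₛ≈* (prodₛ N k) Fₖ) ⟩
    prodₛ N k * Fₖ - u (suc k) * κ
      ≈⟨ solve 5 (λ Π U κ F U' → Π :* F :- U' :* κ := (Π :- U :* κ) :* F :+ (U :* F :- U') :* κ)
               refl (prodₛ N k) (u k) κ Fₖ (u (suc k)) ⟩
    E k * Fₖ + (u k * Fₖ - u (suc k)) * κ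
      ≈⟨ +-congˡ (*-congʳ {κ} (trans (+-cong (*-congˡ {u k} Fₖ≈) (-‿cong u'≈))
           (factor-step-identity t y X (s (suc k)) (g (suc k)) h s-inv g-inv h-inv))) ⟩
    E k * Fₖ + - (c * y * A * h * g (suc k)) * κ
      ≈⟨ +-congˡ (solve 6 (λ c y A κ h g → :- (c :* y :* A :* h :* g) :* κ
                                         := :- (c :* y :* h :* g :* (A :* κ)))
                        refl c y A κ h (g (suc k))) ⟩
    E k * Fₖ + - (c * y * h * g (suc k) * (A * κ))
      ≈⟨ +-congˡ (-‿cong (*-congˡ {c * y * h * g (suc k)} A₁κ)) ⟩
    E k * Fₖ + - (c * y * h * g (suc k) * (𝟙 - t^ 2))
      ≈⟨ +-congˡ (-‿cong (solve 5 (λ t y w h g →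
           (con 1ℤ :- t) :* (con 1ℤ :- y :* t) :* y :* h :* g :* (con 1ℤ :- w)
           := (con 1ℤ :- t) :* ((con 1ℤ :- w) :* ((con 1ℤ :- y :* t) :* (h :* (g :* y)))))
           refl t y (t^ 2) h (g (suc k)))) ⟩
    E k * Fₖ - Δ k ∎
    where
    Fₖ = factorₛ N (suc k)
    y = t^ k
    h = s (2 ℕ.+ k)
    c = (𝟙 - t) * (𝟙 - y * t)
    A = 𝟙 - (X * t - t * t)
    A₁κ : A * κ ≈ 𝟙 - t^ 2
    A₁κ = trans (*-congʳ {κ} (+-congˡ {𝟙} (-‿cong (sym (ρ-expand 1))))) κ-generating
    t^1+k : t^ (suc k) ≈ y * t
    t^1+k = t^-suc k
    t^2+k : t^ (2 ℕ.+ k) ≈ y * t * t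
    t^2+k = trans (t^-suc (suc k)) (*-congʳ {t} t^1+k)
    Fₖ≈ : Fₖ ≈ (𝟙 - y * t) * (𝟙 - y * t) * g (suc k)
    Fₖ≈ = trans (factorₛ-expand (suc k)) (*-congʳ {g (suc k)} (*-cong 1-t^1+k 1-t^1+k))
      where 1-t^1+k = +-congˡ {𝟙} (-‿cong t^1+k)
    u'≈ : u (suc k) ≈ (𝟙 - t) * (𝟙 - y * t) * s (2 ℕ.+ k)
    u'≈ = *-congʳ {s (2 ℕ.+ k)} (*-congˡ {𝟙 - t} (+-congˡ {𝟙} (-‿cong t^1+k)))
    s-inv : (𝟙 - y * t) * s (suc k) ≈ 𝟙
    s-inv = trans (*-congʳ {s (suc k)} (+-congˡ {𝟙} (-‿cong (sym t^1+k)))) (s-inverse k)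
    h-inv : (𝟙 - y * t * t) * s (2 ℕ.+ k) ≈ 𝟙
    h-inv = trans (*-congʳ {s (2 ℕ.+ k)} (+-congˡ {𝟙} (-‿cong (sym t^2+k)))) (s-inverse (suc k))
    g-inv : (𝟙 - (X * (y * t) - y * t * (y * t))) * g (suc k) ≈ 𝟙
    g-inv = trans (*-congʳ {g (suc k)} (+-congˡ {𝟙} (-‿cong (sym ρ≈))))
                  (g-inverse k)
      where
      ρ≈ : ρ (suc k) ≈ X * (y * t) - y * t * (y * t)
      ρ≈ = trans (ρ-expand (suc k)) (+-cong (*-congˡ {X} t^1+k) (-‿cong (*-cong t^1+k t^1+k)))

  ρ-order : ∀ {c} i → c ≤ i → Order≥ c 0 (ρ i)
  ρ-order i c≤i = Order≥-- (Order≥-Xt^ i c≤i) (Order≥-t^ (2 ℕ.* i) z≤n)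

  factorₛ-order : ∀ k → 1 ≤ k → Order≥ 2 0 (factorₛ N (suc k))
  factorₛ-order k 1≤k = Order≥-resp (sym (factorₛ-expand (suc k)))
    (Order≥-* (Order≥-* 𝟙-tᵏ⁺¹ 𝟙-tᵏ⁺¹) (Order≥-geomₛ (ρ-order (suc k) (s≤s 1≤k)) N))
    where
    𝟙-tᵏ⁺¹ : Order≥ 2 0 (𝟙 - t^ (suc k))
    𝟙-tᵏ⁺¹ = Order≥-- (Order≥-constₛ 1ℤ) (Order≥-t^ (suc k) z≤n)

  Δ-order : ∀ k → Order≥ (suc k) k (Δ k)
  Δ-order k =
    Order≥-* (𝟙-tⁱ 1) (Order≥-* (𝟙-tⁱ 2) (Order≥-* 𝟙-tᵏt
      (Order≥-* (Order≥-geomₛ (Order≥-t^ (2 ℕ.+ k) z≤n) N)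
        (Order≥-* (Order≥-geomₛ (ρ-order (suc k) ℕ.≤-refl) N) (Order≥-t^ k ℕ.≤-refl)))))
    where
    𝟙-tⁱ : ∀ i → Order≥ (suc k) 0 (𝟙 - t^ i)
    𝟙-tⁱ i = Order≥-- (Order≥-constₛ 1ℤ) (Order≥-t^ i z≤n)
    𝟙-tᵏt : Order≥ (suc k) 0 (𝟙 - t^ k * t)
    𝟙-tᵏt = Order≥-- (Order≥-constₛ 1ℤ) (Order≥-* (Order≥-t^ k z≤n) (Order≥-t^ 1 z≤n))

  E-order : ∀ k → 1 ≤ k → Order≥ 2 1 (E k)
  E-order (suc zero)    _ = Order≥-resp (sym E-base) Order≥-zero
  E-order (suc (suc k)) _ = Order≥-resp (sym (E-step (suc k)))
    (Order≥-- (Order≥-* (E-order (suc k) (s≤s z≤n)) (factorₛ-order (suc k) (s≤s z≤n)))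
              (Order≥-weaken (s≤s (s≤s z≤n)) (s≤s z≤n) (Δ-order (suc k))))

  t^1+N≈0 : t^ (suc N) ≈ 0#
  t^1+N≈0 = agreeOn λ m m≤N → P.reflexive (monoₛ-off (suc N) (const 1ℤ) m λ { ≡.refl → ℕ.1+n≰n m≤N })

  u-top : u N ≈ 𝟙 - t - t^ N
  u-top = begin
    (𝟙 - t) * (𝟙 - t^ N) * s (suc N)
      ≈⟨ *-congˡ {(𝟙 - t) * (𝟙 - t^ N)} s-top ⟩
    (𝟙 - t) * (𝟙 - t^ N) * 𝟙
      ≈⟨ solve 2 (λ t y → (con 1ℤ :- t) :* (con 1ℤ :- y) :* con 1ℤ
                          := con 1ℤ :- t :- y :+ y :* t) refl t (t^ N) ⟩
    𝟙 - t - t^ N + t^ N * t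
      ≈⟨ +-congˡ (trans (sym (t^-suc N)) t^1+N≈0) ⟩
    𝟙 - t - t^ N + 0#
      ≈⟨ +-identityʳ _ ⟩
    𝟙 - t - t^ N ∎
    where
    s-top : s (suc N) ≈ 𝟙
    s-top = begin
      s (suc N)
        ≈⟨ solve 2 (λ w s → s := (con 1ℤ :- w) :* s :+ w :* s) refl (t^ (suc N)) (s (suc N)) ⟩
      (𝟙 - t^ (suc N)) * s (suc N) + t^ (suc N) * s (suc N)
        ≈⟨ +-cong (s-inverse N) (trans (*-congʳ {s (suc N)} t^1+N≈0) (zeroˡ (s (suc N)))) ⟩
      𝟙 + 0#
        ≈⟨ +-identityʳ 𝟙 ⟩
      𝟙 ∎

  prodₛ-expansion : prodₛ N N ≈ E N + (κ - t * κ - t^ N * κ)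
  prodₛ-expansion = begin
    prodₛ N N
      ≈⟨ solve 3 (λ Π U κ → Π := (Π :- U :* κ) :+ U :* κ) refl (prodₛ N N) (u N) κ ⟩
    E N + u N * κ
      ≈⟨ +-congˡ (trans (*-congʳ {κ} u-top)
           (solve 3 (λ t y κ → (con 1ℤ :- t :- y) :* κ := κ :- t :* κ :- y :* κ) refl t (t^ N) κ)) ⟩
    E N + (κ - t * κ - t^ N * κ) ∎

  prodₛ-top : 1 ≤ N → prodₛ N N N ≐ E N N +ₚ (κ N -ₚ κ (N ∸ 1) -ₚ const 1ℤ)
  prodₛ-top 1≤N = P.trans (agree prodₛ-expansion N ℕ.≤-refl)
    (P.+-congˡ {E N N} (P.+-cong {κ N -ₚ (t * κ) N} {κ N -ₚ κ (N ∸ 1)}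
                                 {negₚ ((t^ N * κ) N)} {negₚ (const 1ℤ)}
                                 (P.+-congˡ {κ N} (P.-‿cong tκ)) (P.-‿cong tᴺκ)))
    where
    tκ : (t * κ) N ≐ κ (N ∸ 1)
    tκ = P.trans (monoₛ-*-≥ 1 (const 1ℤ) κ N 1≤N) (P.*-identityˡ _)
    tᴺκ : (t^ N * κ) N ≐ const 1ℤ
    tᴺκ = P.trans (monoₛ-*-≥ N (const 1ℤ) κ N ℕ.≤-refl)
                  (P.trans (P.*-identityˡ _) (P.reflexive (≡.cong κ (ℕ.n∸n≡0 N))))

X-2*F : ∀ m → X-2 *ₚ F m ≐ 𝒯 (suc m) -ₚ 𝒯 m
X-2*F zero    = mk≐ λ { zero → ≡.refl ; (suc zero) → ≡.refl ; (suc (suc _)) → ≡.refl }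
X-2*F (suc m) = P.trans (P.distribˡ X-2 (F m) (𝒯 (suc m)))
  (P.trans (P.+-congʳ {X-2 *ₚ 𝒯 (suc m)} (X-2*F m))
           (solve 3 (λ x a b → (a :- b) :+ (x :- con (+ 2)) :* a := (x :* a :- b) :- a)
                  P.refl Xₚ (𝒯 (suc m)) (𝒯 m)))
  where open PolySolver

rhsCoeff-high : ∀ M J → 1 ≤ J → 2 ℕ.+ M ≤ 2 ℕ.* J →
  coeff (rhsCoeff (2 ℕ.+ M)) J ≡ coeff (𝒯 (2 ℕ.+ M) -ₚ 𝒯 (1 ℕ.+ M)) J
rhsCoeff-high M J@(suc _) _ N≤2J = begin
  coeff (prodₛ N N N) J
    ≡⟨ coeff-≡ (prodₛ-top (s≤s z≤n)) J ⟩
  coeff (E N N +ₚ (𝒯 N -ₚ 𝒯 (1 ℕ.+ M) -ₚ const 1ℤ)) J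
    ≡⟨ coeff-+ (E N N) _ J ⟩
  coeff (E N N) J ℤ.+ coeff (𝒯 N -ₚ 𝒯 (1 ℕ.+ M) -ₚ const 1ℤ) J
    ≡⟨ ≡.cong₂ ℤ._+_ (vanish (E-order N (s≤s z≤n)) N J ℕ.≤-refl (ℕ.≤-<-trans N≤2J (ℕ.m<m+n _ (s≤s z≤n))))
                 (coeff-- (𝒯 N -ₚ 𝒯 (1 ℕ.+ M)) (const 1ℤ) J) ⟩
  0ℤ ℤ.+ (coeff (𝒯 N -ₚ 𝒯 (1 ℕ.+ M)) J ℤ.- 0ℤ)
    ≡⟨ ≡.trans (ℤ.+-identityˡ _) (ℤ.+-identityʳ _) ⟩
  coeff (𝒯 N -ₚ 𝒯 (1 ℕ.+ M)) J ∎
  where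
  N = 2 ℕ.+ M
  open ≡.≡-Reasoning
  open ProductFormula N
  open Truncated N using (vanish)

coeff-X-2*P̃ : ∀ n J → 1 ≤ J → coeff (X-2 *ₚ P̃ n) J ≡ coeff (rhsCoeff n) J
coeff-X-2*P̃ n J@(suc _) _ = ≡.sym (≡.trans (coeff-≡ (divX-2-spec (rhsCoeff n)) J)
  (≡.trans (coeff-+ (X-2 *ₚ P̃ n) _ J) (ℤ.+-identityʳ _)))

coeff-X-2*[P̃-F] : ∀ M j → M ≤ 2 ℕ.* j →
  coeff (X-2 *ₚ (P̃ (2 ℕ.+ M) -ₚ F (1 ℕ.+ M))) (suc j) ≡ 0ℤ
coeff-X-2*[P̃-F] M j M≤2j = begin
  coeff (X-2 *ₚ (P̃ n -ₚ F (1 ℕ.+ M))) J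
    ≡⟨ coeff-≡ (solve 3 (λ y a b → y :* (a :- b) := y :* a :- y :* b) P.refl X-2 (P̃ n) (F (1 ℕ.+ M))) J ⟩
  coeff (X-2 *ₚ P̃ n -ₚ X-2 *ₚ F (1 ℕ.+ M)) J
    ≡⟨ coeff-- (X-2 *ₚ P̃ n) _ J ⟩
  coeff (X-2 *ₚ P̃ n) J ℤ.- coeff (X-2 *ₚ F (1 ℕ.+ M)) J
    ≡⟨ ≡.cong₂ ℤ._-_ (coeff-X-2*P̃ n J (s≤s z≤n)) (coeff-≡ (X-2*F (1 ℕ.+ M)) J) ⟩
  coeff (rhsCoeff n) J ℤ.- coeff (𝒯 n -ₚ 𝒯 (1 ℕ.+ M)) J
    ≡⟨ ≡.cong (ℤ._- coeff (𝒯 n -ₚ 𝒯 (1 ℕ.+ M)) J) (rhsCoeff-high M J (s≤s z≤n) n≤2J) ⟩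
  coeff (𝒯 n -ₚ 𝒯 (1 ℕ.+ M)) J ℤ.- coeff (𝒯 n -ₚ 𝒯 (1 ℕ.+ M)) J
    ≡⟨ ℤ.+-inverseʳ (coeff (𝒯 n -ₚ 𝒯 (1 ℕ.+ M)) J) ⟩
  0ℤ ∎
  where
  open ≡.≡-Reasoning
  open PolySolver
  n = 2 ℕ.+ M
  J = suc j
  n≤2J : n ≤ 2 ℕ.* J
  n≤2J = ≡.subst (n ≤_) (≡.sym (ℕ.*-suc 2 j)) (s≤s (s≤s M≤2j))

theorem4p1 : ∀ (n : ℕ) → 2 ≤ n → DegLtHalf (P̃ n -ₚ F (n ∸ 1)) (n ∸ 2)
theorem4p1 (suc (suc M)) _ =
  coeff-X-2*≡0⇒coeff≡0 (P̃ (2 ℕ.+ M) -ₚ F (1 ℕ.+ M)) (λ k → M ≤ 2 ℕ.* k)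
    (λ M≤2k → ℕ.≤-trans M≤2k (ℕ.*-monoʳ-≤ 2 (ℕ.n≤1+n _)))
    (coeff-X-2*[P̃-F] M)
theorem4p1 (suc zero) (s≤s ())
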